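{- Let $G$ be a binary Cayley graph of odd-girth $7$. If $G$ admits a homomorphism to $\mathcal{PC}_4$, then every homomorphism from $G$ to $\mathcal{PC}_4$ is surjective (onto the vertex set of $\mathcal{PC}_4$).
   Context: A binary Cayley graph is a Cayley graph $\mathrm{Cay}(\Gamma,\Omega)$ where $\Gamma$ is a group (written additively) with $x+x=0$ for all $x\in\Gamma$ and $\Omega\subseteq\Gamma$; its vertex set is $\Gamma$, with $u\sim v$ iff $u-v\in\Omega$. The odd-girth is the length of a shortest odd cycle. The projective cube $\mathcal{PC}_4$ is the Cayley graph on $\mathbb{Z}_2^4$ with $u\sim v$ iff $u-v\in\{e_1,e_2,e_3,e_4,J\}$, where $e_i$ are the canonical basis vectors and $J$ is the all-ones vector. A homomorphism is a map of vertex sets sending edges to edges. -}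

module Defs where

open import Data.Nat using (ℕ; zero; suc; _≤_; _%_)
open import Data.Fin using (Fin; zero; suc; inject₁; fromℕ)
open import Data.Bool using (Bool; true; false; _xor_)
open import Data.Vec using (Vec; []; _∷_; zipWith)
open import Data.List using (List; []; _∷_)
open import Data.List.Membership.Propositional using (_∈_)
open import Data.Product using (Σ; _×_; ∃)
open import Function.Definitions using (Injective)
open import Relation.Binary.PropositionalEquality using (_≡_)
open import Algebra.Core using (Op₁; Op₂)

Odd : ℕ → Set
Odd n = n % 2 ≡ 1

CayAdj : {Γ : Set} → Op₂ Γ → Op₁ Γ → (Γ → Set) → Γ → Γ → Set
CayAdj _+_ -_ Ω u v = Ω (u + (- v))

-- A cycle of length suc m (≥ 3): pairwise distinct vertices
-- v₀, …, v_m with v_i ~ v_{i+1} and v_m ~ v₀.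
HasCycle : {V : Set} → (V → V → Set) → ℕ → Set
HasCycle {V} adj zero = Data.Empty.⊥
  where import Data.Empty
HasCycle {V} adj (suc m) =
  (2 ≤ m) ×
  Σ (Fin (suc m) → V) λ v →
    Injective _≡_ _≡_ v ×
    ((i : Fin m) → adj (v (inject₁ i)) (v (suc i))) ×
    adj (v (fromℕ m)) (v zero)

OddGirth : {V : Set} → (V → V → Set) → ℕ → Set
OddGirth adj g =
  Odd g × HasCycle adj g × ((n : ℕ) → Odd n → HasCycle adj n → g ≤ n)

V4 : Set
V4 = Vec Bool 4

PC4gens : List V4
PC4gens =
  (true ∷ false ∷ false ∷ false ∷ []) ∷
  (false ∷ true ∷ false ∷ false ∷ []) ∷
  (false ∷ false ∷ true ∷ false ∷ []) ∷
  (false ∷ false ∷ false ∷ true ∷ []) ∷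
  (true ∷ true ∷ true ∷ true ∷ []) ∷ []

PC4Adj : V4 → V4 → Set
PC4Adj u v = zipWith _xor_ u v ∈ PC4gens

IsHom : {V W : Set} → (V → V → Set) → (W → W → Set) → (V → W) → Set
IsHom {V} adjV adjW f = (u v : V) → adjV u v → adjW (f u) (f v)

module Submission where

-- A 7-cycle of G has steps s₀, …, s₆ ∈ Ω summing to 0. From any vertex c they span the cube map
-- i ↦ c + Σₖ iₖ sₖ (k < 6), a homomorphism PC(6) → G: flipping coordinate k adds sₖ and
-- complementing adds s₀ + … + s₅ = s₆. So it suffices that no homomorphism PC(6) → PC(4) misses a
-- vertex y, a finite fact proved by a certified search: a generic refutation procedure (arc
-- consistency and recorded case splits), proved sound, is evaluated by the type checker. To keep
-- the search small, symmetry is broken first: a translation moves y to 𝟎, a linear automorphism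
-- of PC(4) moves f(c) to e₁ or e₁ + e₂, the seven steps are sorted by their relabelled images,
-- and c is chosen among v₁, v₃, v₅ so that these images are not all equal (PC(4) has no loops).

open import Defs
open import Algebra.Core using (Op₁; Op₂)
open import Algebra.Structures using (IsGroup; IsCommutativeMonoid)
open import Data.Bool using (Bool; true; false; not; _xor_; _∧_; if_then_else_; T)
import Data.Bool as Bool
open import Data.Bool.ListAction using (any)
open import Data.Bool.Properties using (xor-assoc; xor-identityʳ; xor-same; T-∧; T?)
open import Data.Empty using (⊥; ⊥-elim)
open import Data.Fin using (Fin; zero; suc; #_)
open import Data.List using (List; []; _∷_; _++_; length; map; concat; filter; filterᵇ; foldr; drop; allFin)
open import Data.List.Membership.Propositional using (_∈_; lose)
open import Data.List.Membership.Propositional.Properties using (∈-map⁺; ∈-concat⁺′; ∈-filter⁺)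
open import Data.List.Relation.Unary.All as All using (All; []; _∷_; all?)
open import Data.List.Relation.Unary.All.Properties using (map⁺; ++⁺; all-filter; filter⁺)
open import Data.List.Relation.Unary.Any as Any using (here; there; any?)
open import Data.List.Relation.Unary.Any.Properties using (any⁺)
open import Data.List.Relation.Unary.Linked using (Linked; []; [-]; _∷_)
open import Data.List.Relation.Unary.Linked.Properties using (Linked⇒All)
open import Data.List.Relation.Binary.Permutation.Propositional using (_↭_; ↭-sym; ↭⇒↭ₛ)
open import Data.List.Relation.Binary.Permutation.Propositional.Properties using (All-resp-↭; ∈-resp-↭; ↭-length)
import Data.List.Relation.Binary.Permutation.Setoid.Properties as PermutationProperties
import Data.List.Sort as Sort
open import Data.Nat using (ℕ; zero; suc; _*_; _≤_; _<_; _≡ᵇ_; _<ᵇ_; _%_; _/_)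
open import Data.Nat.Properties
  using (<⇒<ᵇ; <ᵇ⇒<; <⇒≱; even≢odd; *-cancelˡ-≡; suc-injective; ≤-refl; ≤-trans; ≤-antisym; ≤∧≢⇒<; ≤-decTotalOrder)
open import Data.Product using (Σ; _×_; ∃; _,_; proj₁; proj₂)
open import Data.Sum using (_⊎_; inj₁; inj₂)
open import Data.Unit using (tt)
open import Data.Vec using (Vec; []; _∷_; zipWith; replicate; updateAt; lookup; toList)
open import Data.Vec.Properties using (≡-dec; zipWith-assoc; zipWith-identityˡ; zipWith-identityʳ)
import Data.Vec.Relation.Unary.All as VecAll
open import Data.Vec.Relation.Unary.All.Properties using (lookup⁺)
open import Function using (_∘_; Equivalence)
import Relation.Binary.Construct.On as On
open import Relation.Binary.PropositionalEquality
open import Relation.Nullary using (¬_; Dec; yes; no; ¬?; _×-dec_; _⊎-dec_)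
open import Relation.Nullary.Decidable using (from-yes)

open import Data.List.Membership.DecPropositional (≡-dec {n = 4} Bool._≟_) using (_∈?_)

module Exponent2 {Γ : Set} {_+_ : Op₂ Γ} {0# : Γ} { -_ : Op₁ Γ}
  (isGroup : IsGroup _≡_ _+_ 0# -_) (self-inverse : ∀ x → x + x ≡ 0#) where

  open IsGroup isGroup using (assoc; identityˡ; identityʳ; inverseˡ; isMonoid)
  open ≡-Reasoning

  cancelˡ : ∀ a b → a + (a + b) ≡ b
  cancelˡ a b = begin
    a + (a + b) ≡⟨ assoc a a b ⟨
    (a + a) + b ≡⟨ cong (_+ b) (self-inverse a) ⟩
    0# + b      ≡⟨ identityˡ b ⟩
    b           ∎

  cancelʳ : ∀ a b → (a + b) + b ≡ a
  cancelʳ a b = begin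
    (a + b) + b ≡⟨ assoc a b b ⟩
    a + (b + b) ≡⟨ cong (a +_) (self-inverse b) ⟩
    a + 0#      ≡⟨ identityʳ a ⟩
    a           ∎

  sum-zero⇒≡ : ∀ a b → a + b ≡ 0# → a ≡ b
  sum-zero⇒≡ a b a+b≡0 = begin
    a           ≡⟨ cancelʳ a b ⟨
    (a + b) + b ≡⟨ cong (_+ b) a+b≡0 ⟩
    0# + b      ≡⟨ identityˡ b ⟩
    b           ∎

  neg : ∀ a → - a ≡ a
  neg a = sum-zero⇒≡ (- a) a (inverseˡ a)

  comm : ∀ a b → a + b ≡ b + a
  comm a b = sum-zero⇒≡ (a + b) (b + a) (begin
    (a + b) + (b + a) ≡⟨ assoc a b (b + a) ⟩
    a + (b + (b + a)) ≡⟨ cong (a +_) (cancelˡ b a) ⟩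
    a + a             ≡⟨ self-inverse a ⟩
    0#                ∎)

  interchange : ∀ a b c d → (a + b) + (c + d) ≡ (a + c) + (b + d)
  interchange a b c d = begin
    (a + b) + (c + d) ≡⟨ assoc a b (c + d) ⟩
    a + (b + (c + d)) ≡⟨ cong (a +_) (assoc b c d) ⟨
    a + ((b + c) + d) ≡⟨ cong (λ z → a + (z + d)) (comm b c) ⟩
    a + ((c + b) + d) ≡⟨ cong (a +_) (assoc c b d) ⟩
    a + (c + (b + d)) ≡⟨ assoc a c (b + d) ⟨
    (a + c) + (b + d) ∎

  isCommutativeMonoid : IsCommutativeMonoid _≡_ _+_ 0#
  isCommutativeMonoid = record { isMonoid = isMonoid ; comm = comm }

_⊕_ : ∀ {n} → Vec Bool n → Vec Bool n → Vec Bool n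
_⊕_ = zipWith _xor_

𝟎 : ∀ {n} → Vec Bool n
𝟎 = replicate _ false

⊕-self : ∀ {n} (v : Vec Bool n) → v ⊕ v ≡ 𝟎
⊕-self [] = refl
⊕-self (b ∷ v) = cong₂ _∷_ (xor-same b) (⊕-self v)

⊕-isGroup : ∀ {n} → IsGroup _≡_ (_⊕_ {n}) 𝟎 (λ v → v)
⊕-isGroup = record
  { isMonoid = record
    { isSemigroup = record
      { isMagma = record { isEquivalence = isEquivalence ; ∙-cong = cong₂ _⊕_ }
      ; assoc = zipWith-assoc xor-assoc }
    ; identity = zipWith-identityˡ (λ _ → refl) , zipWith-identityʳ xor-identityʳ }
  ; inverse = ⊕-self , ⊕-self
  ; ⁻¹-cong = λ eq → eq }

module ℤ₂ⁿ {n : ℕ} = Exponent2 (⊕-isGroup {n}) ⊕-self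

-- All vectors of length n, by increasing binary value (first coordinate least significant).
vectors : (n : ℕ) → List (Vec Bool n)
vectors zero = [] ∷ []
vectors (suc n) = concat (map (λ v → (false ∷ v) ∷ (true ∷ v) ∷ []) (vectors n))

∈-vectors : ∀ {n} (v : Vec Bool n) → v ∈ vectors n
∈-vectors [] = here refl
∈-vectors (false ∷ v) = ∈-concat⁺′ (here refl) (∈-map⁺ _ (∈-vectors v))
∈-vectors (true ∷ v) = ∈-concat⁺′ (there (here refl)) (∈-map⁺ _ (∈-vectors v))

value : ∀ {n} → Vec Bool n → ℕ
value [] = 0
value (false ∷ v) = 2 * value v
value (true ∷ v) = suc (2 * value v)

value-injective : ∀ {n} (u v : Vec Bool n) → value u ≡ value v → u ≡ v
value-injective [] [] _ = refl
value-injective (false ∷ u) (false ∷ v) eq =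
  cong (false ∷_) (value-injective u v (*-cancelˡ-≡ (value u) (value v) 2 eq))
value-injective (true ∷ u) (true ∷ v) eq =
  cong (true ∷_) (value-injective u v (*-cancelˡ-≡ (value u) (value v) 2 (suc-injective eq)))
value-injective (false ∷ u) (true ∷ v) eq = ⊥-elim (even≢odd (value u) (value v) eq)
value-injective (true ∷ u) (false ∷ v) eq = ⊥-elim (even≢odd (value v) (value u) (sym eq))

-- The vector with binary value m; it names the variables of a certificate compactly.
bits : (n : ℕ) → ℕ → Vec Bool n
bits zero m = []
bits (suc n) m = (m % 2 ≡ᵇ 1) ∷ bits n (m / 2)

-- The projective cube PC(n) is the Cayley graph on ℤ₂ⁿ with generators the unit vectors and
-- the all-ones vector: the neighbours of i flip one coordinate of i, or all of them.
flipAt : ∀ {n} → Fin n → Vec Bool n → Vec Bool n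
flipAt k i = updateAt i k not

complement : ∀ {n} → Vec Bool n → Vec Bool n
complement = Data.Vec.map not

unit : ∀ {n} → Fin n → Vec Bool n
unit k = flipAt k 𝟎

𝟏 : ∀ {n} → Vec Bool n
𝟏 = complement 𝟎

record IsPCHom {n : ℕ} {W : Set} (adj : W → W → Set) (h : Vec Bool n → W) : Set where
  field
    along-flip       : ∀ i k → adj (h i) (h (flipAt k i))
    along-complement : ∀ i → adj (h i) (h (complement i))

∘-IsPCHom : ∀ {n} {A B : Set} {adjA : A → A → Set} {adjB : B → B → Set} {p : Vec Bool n → A} {g : A → B} →
  IsPCHom adjA p → (∀ {a b} → adjA a b → adjB (g a) (g b)) → IsPCHom adjB (g ∘ p)
∘-IsPCHom hom g-hom = record
  { along-flip = λ i k → g-hom (IsPCHom.along-flip hom i k)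
  ; along-complement = λ i → g-hom (IsPCHom.along-complement hom i) }

e₁ e₂ e₃ e₄ 𝐣 : V4
e₁ = true ∷ false ∷ false ∷ false ∷ []
e₂ = false ∷ true ∷ false ∷ false ∷ []
e₃ = false ∷ false ∷ true ∷ false ∷ []
e₄ = false ∷ false ∷ false ∷ true ∷ []
𝐣 = true ∷ true ∷ true ∷ true ∷ []

nonzero : List V4
nonzero = drop 1 (vectors 4)

∈-nonzero : ∀ v → v ≢ 𝟎 → v ∈ nonzero
∈-nonzero v v≢𝟎 with ∈-vectors v
... | here v≡𝟎 = ⊥-elim (v≢𝟎 v≡𝟎)
... | there v∈ = v∈

𝟎∉generators : ¬ (𝟎 ∈ PC4gens)
𝟎∉generators (there (there (there (there (there ())))))

no-loop : ∀ a → ¬ PC4Adj a a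
no-loop a adj = 𝟎∉generators (subst (_∈ PC4gens) (⊕-self a) adj)

translate-adj : ∀ {a b} y → PC4Adj a b → PC4Adj (a ⊕ y) (b ⊕ y)
translate-adj {a} {b} y adj = subst (_∈ PC4gens) (sym (begin
  (a ⊕ y) ⊕ (b ⊕ y) ≡⟨ ℤ₂ⁿ.interchange a y b y ⟩
  (a ⊕ b) ⊕ (y ⊕ y) ≡⟨ cong ((a ⊕ b) ⊕_) (⊕-self y) ⟩
  (a ⊕ b) ⊕ 𝟎       ≡⟨ IsGroup.identityʳ ⊕-isGroup (a ⊕ b) ⟩
  a ⊕ b             ∎)) adj
  where open ≡-Reasoning

linear : ∀ {m n} → Vec (Vec Bool m) n → Vec Bool n → Vec Bool m
linear [] [] = 𝟎
linear (c ∷ cs) (b ∷ v) = (if b then c else 𝟎) ⊕ linear cs v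

linear-⊕ : ∀ {m n} (cs : Vec (Vec Bool m) n) u v → linear cs (u ⊕ v) ≡ linear cs u ⊕ linear cs v
linear-⊕ [] [] [] = sym (⊕-self 𝟎)
linear-⊕ (c ∷ cs) (a ∷ u) (b ∷ v) = begin
  scale (a xor b) ⊕ linear cs (u ⊕ v)                ≡⟨ cong₂ _⊕_ (scale-xor a b) (linear-⊕ cs u v) ⟩
  (scale a ⊕ scale b) ⊕ (linear cs u ⊕ linear cs v) ≡⟨ ℤ₂ⁿ.interchange (scale a) (scale b) _ _ ⟩
  (scale a ⊕ linear cs u) ⊕ (scale b ⊕ linear cs v) ∎
  where
  open ≡-Reasoning
  scale : Bool → Vec Bool _
  scale b = if b then c else 𝟎
  scale-xor : ∀ a b → scale (a xor b) ≡ scale a ⊕ scale b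
  scale-xor false b = sym (IsGroup.identityˡ ⊕-isGroup (scale b))
  scale-xor true false = sym (IsGroup.identityʳ ⊕-isGroup c)
  scale-xor true true = sym (⊕-self c)

-- Normalisers: for each non-zero u, a linear automorphism of PC(4) (fixing 𝟎) sending u to e₁
-- if u is a neighbour of 𝟎, and to e₁ + e₂ otherwise. It sends the unit vectors to four
-- distinct generators, listed here by the binary value of u.
normaliserColumns : ℕ → Vec V4 4
normaliserColumns 2 = e₂ ∷ e₁ ∷ e₃ ∷ e₄ ∷ []
normaliserColumns 4 = e₃ ∷ e₂ ∷ e₁ ∷ e₄ ∷ []
normaliserColumns 5 = e₁ ∷ e₃ ∷ e₂ ∷ e₄ ∷ []
normaliserColumns 6 = e₃ ∷ e₂ ∷ e₁ ∷ e₄ ∷ []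
normaliserColumns 7 = e₄ ∷ 𝐣 ∷ e₃ ∷ e₁ ∷ []
normaliserColumns 8 = e₄ ∷ e₂ ∷ e₃ ∷ e₁ ∷ []
normaliserColumns 9 = e₁ ∷ e₄ ∷ e₃ ∷ e₂ ∷ []
normaliserColumns 10 = e₄ ∷ e₂ ∷ e₃ ∷ e₁ ∷ []
normaliserColumns 11 = e₃ ∷ 𝐣 ∷ e₁ ∷ e₄ ∷ []
normaliserColumns 12 = e₃ ∷ e₄ ∷ e₁ ∷ e₂ ∷ []
normaliserColumns 13 = 𝐣 ∷ e₂ ∷ e₃ ∷ e₄ ∷ []
normaliserColumns 14 = e₁ ∷ 𝐣 ∷ e₃ ∷ e₄ ∷ []
normaliserColumns 15 = 𝐣 ∷ e₂ ∷ e₃ ∷ e₄ ∷ []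
normaliserColumns _ = e₁ ∷ e₂ ∷ e₃ ∷ e₄ ∷ []

normalise : V4 → V4 → V4
normalise u = linear (normaliserColumns (value u))

Canonical : V4 → Set
Canonical v = v ≡ e₁ ⊎ v ≡ e₁ ⊕ e₂

GoodNormaliser : V4 → Set
GoodNormaliser u =
  All (λ g → normalise u g ∈ PC4gens) PC4gens ×
  All (λ v → normalise u v ≢ 𝟎) nonzero ×
  Canonical (normalise u u)

normalisers-good : All GoodNormaliser nonzero
normalisers-good = from-yes (all? good? nonzero)
  where
  _≟_ = ≡-dec {n = 4} Bool._≟_
  good? : ∀ u → Dec (GoodNormaliser u)
  good? u = all? (λ g → normalise u g ∈? PC4gens) PC4gens
        ×-dec all? (λ v → ¬? (normalise u v ≟ 𝟎)) nonzero
        ×-dec (normalise u u ≟ e₁ ⊎-dec normalise u u ≟ (e₁ ⊕ e₂))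

module Normaliser (u : V4) (u≢𝟎 : u ≢ 𝟎) where

  private
    good : GoodNormaliser u
    good = All.lookup normalisers-good (∈-nonzero u u≢𝟎)

  N : V4 → V4
  N = normalise u

  N-⊕ : ∀ a b → N (a ⊕ b) ≡ N a ⊕ N b
  N-⊕ = linear-⊕ (normaliserColumns (value u))

  N-𝟎 : N 𝟎 ≡ 𝟎
  N-𝟎 = trans (cong N (sym (⊕-self 𝟎))) (trans (N-⊕ 𝟎 𝟎) (⊕-self (N 𝟎)))

  adj : ∀ {a b} → PC4Adj a b → PC4Adj (N a) (N b)
  adj {a} {b} a~b = subst (_∈ PC4gens) (N-⊕ a b) (All.lookup (proj₁ good) a~b)

  injective : ∀ a b → N a ≡ N b → a ≡ b
  injective a b Na≡Nb with ≡-dec Bool._≟_ (a ⊕ b) 𝟎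
  ... | yes a⊕b≡𝟎 = ℤ₂ⁿ.sum-zero⇒≡ a b a⊕b≡𝟎
  ... | no a⊕b≢𝟎 = ⊥-elim (All.lookup (proj₁ (proj₂ good)) (∈-nonzero (a ⊕ b) a⊕b≢𝟎) (begin
    N (a ⊕ b) ≡⟨ N-⊕ a b ⟩
    N a ⊕ N b ≡⟨ cong (_⊕ N b) Na≡Nb ⟩
    N b ⊕ N b ≡⟨ ⊕-self (N b) ⟩
    𝟎         ∎))
    where open ≡-Reasoning

  canonical : Canonical (N u)
  canonical = proj₂ (proj₂ good)

-- A complete binary trie of depth n: a finite map on Vec Bool n with fast lookup and update.
data Trie (A : Set) : ℕ → Set where
  leaf : A → Trie A zero
  node : ∀ {n} → Trie A n → Trie A n → Trie A (suc n)

module _ {A : Set} where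

  lookupᵀ : ∀ {n} → Trie A n → Vec Bool n → A
  lookupᵀ (leaf a) [] = a
  lookupᵀ (node l r) (false ∷ i) = lookupᵀ l i
  lookupᵀ (node l r) (true ∷ i) = lookupᵀ r i

  updateᵀ : ∀ {n} → Trie A n → Vec Bool n → A → Trie A n
  updateᵀ (leaf _) [] a = leaf a
  updateᵀ (node l r) (false ∷ i) a = node (updateᵀ l i a) r
  updateᵀ (node l r) (true ∷ i) a = node l (updateᵀ r i a)

  tabulateᵀ : ∀ {n} → (Vec Bool n → A) → Trie A n
  tabulateᵀ {zero} F = leaf (F [])
  tabulateᵀ {suc n} F = node (tabulateᵀ (F ∘ (false ∷_))) (tabulateᵀ (F ∘ (true ∷_)))

  lookup-update-same : ∀ {n} (t : Trie A n) i a → lookupᵀ (updateᵀ t i a) i ≡ a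
  lookup-update-same (leaf _) [] a = refl
  lookup-update-same (node l r) (false ∷ i) a = lookup-update-same l i a
  lookup-update-same (node l r) (true ∷ i) a = lookup-update-same r i a

  lookup-update-other : ∀ {n} (t : Trie A n) i j a → j ≢ i → lookupᵀ (updateᵀ t i a) j ≡ lookupᵀ t j
  lookup-update-other (leaf _) [] [] a j≢i = ⊥-elim (j≢i refl)
  lookup-update-other (node l r) (false ∷ i) (false ∷ j) a j≢i =
    lookup-update-other l i j a (j≢i ∘ cong (false ∷_))
  lookup-update-other (node l r) (false ∷ i) (true ∷ j) a _ = refl
  lookup-update-other (node l r) (true ∷ i) (false ∷ j) a _ = refl
  lookup-update-other (node l r) (true ∷ i) (true ∷ j) a j≢i =
    lookup-update-other r i j a (j≢i ∘ cong (true ∷_))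

  lookup-tabulate : ∀ {n} (F : Vec Bool n → A) i → lookupᵀ (tabulateᵀ F) i ≡ F i
  lookup-tabulate F [] = refl
  lookup-tabulate F (false ∷ i) = lookup-tabulate (F ∘ (false ∷_)) i
  lookup-tabulate F (true ∷ i) = lookup-tabulate (F ∘ (true ∷_)) i

-- Certified refutation of binary constraint networks on the variables Vec Bool n with values
-- in V. A network gives, for each variable x, arcs (y , r): the values at x and y satisfy r.
-- Propagation (arc consistency) narrows a domain per variable; a certificate records case
-- splits. Soundness: a solution admitted by the initial domains is never removed, so a
-- network refuted from those domains has no such solution.
module Refutation {V R : Set} (holds : R → V → V → Bool) (n : ℕ) where

  Var : Set
  Var = Vec Bool n

  Network : Set
  Network = Trie (List (Var × R)) n

  Domains : Set
  Domains = Trie (List V) n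

  -- Either some domain became empty, or narrowed domains with variables still to revisit.
  data Outcome : Set where
    wipeout : Outcome
    narrowed : Domains → List Var → Outcome

  revise : R → List V → List V → List V
  revise r dx dy = filterᵇ (λ t → any (λ s → holds r s t) dx) dy

  restrict : Var → List V → Domains → List Var → Outcome
  restrict y [] D w = wipeout
  restrict y d@(_ ∷ _) D w with length d ≡ᵇ length (lookupᵀ D y)
  ... | true = narrowed D w
  ... | false = narrowed (updateᵀ D y d) (y ∷ w)

  reviseArc : List V → Var × R → Outcome → Outcome
  reviseArc dx (y , r) wipeout = wipeout
  reviseArc dx (y , r) (narrowed D w) = restrict y (revise r dx (lookupᵀ D y)) D w

  reviseArcs : List V → List (Var × R) → Outcome → Outcome
  reviseArcs dx [] o = o
  reviseArcs dx (a ∷ as) o = reviseArcs dx as (reviseArc dx a o)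

  propagate : Network → ℕ → Outcome → Outcome
  propagate C zero o = o
  propagate C (suc k) wipeout = wipeout
  propagate C (suc k) (narrowed D []) = narrowed D []
  propagate C (suc k) (narrowed D (x ∷ w)) =
    propagate C k (reviseArcs (lookupᵀ D x) (lookupᵀ C x) (narrowed D w))

  fuel : ℕ
  fuel = 100000

  assign : Network → Domains → Var → V → Outcome
  assign C D x v = propagate C fuel (narrowed (updateᵀ D x (v ∷ [])) (x ∷ []))

  -- at k cs splits on the variable with binary value k; the sub-certificates cs refute, in
  -- order, those values of its domain that propagation alone does not refute.
  data Certificate : Set where
    at : ℕ → List Certificate → Certificate

  mutual
    refutes : Network → Certificate → Domains → Bool
    refutes C (at k cs) D = refutesValues C (bits n k) D (lookupᵀ D (bits n k)) cs

    refutesValues : Network → Var → Domains → List V → List Certificate → Bool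
    refutesValues C x D [] cs = true
    refutesValues C x D (v ∷ vs) cs = refutesAfter C x D vs cs (assign C D x v)

    refutesAfter : Network → Var → Domains → List V → List Certificate → Outcome → Bool
    refutesAfter C x D vs cs wipeout = refutesValues C x D vs cs
    refutesAfter C x D vs [] (narrowed _ _) = false
    refutesAfter C x D vs (c ∷ cs) (narrowed D′ _) = refutes C c D′ ∧ refutesValues C x D vs cs

  refutedFrom : Network → Certificate → Outcome → Bool
  refutedFrom C c wipeout = true
  refutedFrom C c (narrowed D _) = refutes C c D

  refuted : Network → Domains → Certificate → Bool
  refuted C D c = refutedFrom C c (propagate C fuel (narrowed D (vectors n)))

  module Soundness (C : Network) (G : Var → V) where

    Satisfies : Set
    Satisfies = ∀ x → All (λ a → T (holds (proj₂ a) (G x) (G (proj₁ a)))) (lookupᵀ C x)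

    Admits : Domains → Set
    Admits D = ∀ x → G x ∈ lookupᵀ D x

    Admitted : Outcome → Set
    Admitted wipeout = ⊥
    Admitted (narrowed D _) = Admits D

    admits-update : ∀ D y d → Admits D → G y ∈ d → Admits (updateᵀ D y d)
    admits-update D y d adm gy x with ≡-dec Bool._≟_ x y
    ... | yes refl = subst (G y ∈_) (sym (lookup-update-same D y d)) gy
    ... | no x≢y = subst (G x ∈_) (sym (lookup-update-other D y x d x≢y)) (adm x)

    revise-sound : ∀ r {x y} dx dy → G x ∈ dx → G y ∈ dy → T (holds r (G x) (G y)) → G y ∈ revise r dx dy
    revise-sound r dx dy gx gy h =
      ∈-filter⁺ (T? ∘ λ t → any (λ s → holds r s t) dx) gy (any⁺ _ (Any.map (λ { refl → h }) gx))

    restrict-sound : ∀ y d D w → Admits D → G y ∈ d → Admitted (restrict y d D w)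
    restrict-sound y d@(_ ∷ _) D w adm gy with length d ≡ᵇ length (lookupᵀ D y)
    ... | true = adm
    ... | false = admits-update D y d adm gy

    reviseArcs-sound : ∀ {x} dx as o → G x ∈ dx → All (λ a → T (holds (proj₂ a) (G x) (G (proj₁ a)))) as →
      Admitted o → Admitted (reviseArcs dx as o)
    reviseArcs-sound dx [] o gx [] adm = adm
    reviseArcs-sound dx ((y , r) ∷ as) (narrowed D w) gx (h ∷ hs) adm =
      reviseArcs-sound dx as _ gx hs (restrict-sound y _ D w adm (revise-sound r dx _ gx (adm y) h))

    module _ (sat : Satisfies) where

      propagate-sound : ∀ k o → Admitted o → Admitted (propagate C k o)
      propagate-sound zero o adm = adm
      propagate-sound (suc k) (narrowed D []) adm = adm
      propagate-sound (suc k) (narrowed D (x ∷ w)) adm =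
        propagate-sound k (reviseArcs (lookupᵀ D x) (lookupᵀ C x) (narrowed D w))
          (reviseArcs-sound _ _ (narrowed D w) (adm x) (sat x) adm)

      -- Following G's value at each split, G stays admitted and eventually meets a wipeout.
      mutual
        refutes-sound : ∀ c D → Admits D → T (refutes C c D) → ⊥
        refutes-sound (at k cs) D adm = refutesValues-sound (bits n k) D _ cs adm (adm (bits n k))

        refutesValues-sound : ∀ x D vs cs → Admits D → G x ∈ vs → T (refutesValues C x D vs cs) → ⊥
        refutesValues-sound x D (v ∷ vs) cs adm (here gx≡v) =
          refutesAfter-hit x D vs cs (assign C D x v)
            (propagate-sound fuel (narrowed (updateᵀ D x (v ∷ [])) (x ∷ []))
              (admits-update D x (v ∷ []) adm (here gx≡v)))
        refutesValues-sound x D (v ∷ vs) cs adm (there gx) =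
          refutesAfter-miss x D vs cs (assign C D x v) adm gx

        refutesAfter-hit : ∀ x D vs cs o → Admitted o → T (refutesAfter C x D vs cs o) → ⊥
        refutesAfter-hit x D vs (c ∷ cs) (narrowed D′ _) adm′ ok =
          refutes-sound c D′ adm′ (proj₁ (Equivalence.to T-∧ ok))

        refutesAfter-miss : ∀ x D vs cs o → Admits D → G x ∈ vs → T (refutesAfter C x D vs cs o) → ⊥
        refutesAfter-miss x D vs cs wipeout adm gx ok = refutesValues-sound x D vs cs adm gx ok
        refutesAfter-miss x D vs (c ∷ cs) (narrowed _ _) adm gx ok =
          refutesValues-sound x D vs cs adm gx (proj₂ (Equivalence.to T-∧ ok))

      refuted-sound : ∀ D c → Admits D → T (refuted C D c) → ⊥
      refuted-sound D c adm = from (propagate C fuel (narrowed D (vectors n)))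
                                   (propagate-sound fuel (narrowed D (vectors n)) adm)
        where
        from : ∀ o → Admitted o → T (refutedFrom C c o) → ⊥
        from (narrowed D′ _) adm′ = refutes-sound c D′ adm′

-- The search for homomorphisms PC(6) → PC(4) avoiding 𝟎, on the variables Idx = ℤ₂⁶.
Idx : Set
Idx = Vec Bool 6

isGenerator : V4 → Bool
isGenerator (true ∷ false ∷ false ∷ false ∷ []) = true
isGenerator (false ∷ true ∷ false ∷ false ∷ []) = true
isGenerator (false ∷ false ∷ true ∷ false ∷ []) = true
isGenerator (false ∷ false ∷ false ∷ true ∷ []) = true
isGenerator (true ∷ true ∷ true ∷ true ∷ []) = true
isGenerator _ = false

isGenerator-complete : ∀ {v} → v ∈ PC4gens → T (isGenerator v)
isGenerator-complete (here refl) = tt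
isGenerator-complete (there (here refl)) = tt
isGenerator-complete (there (there (here refl))) = tt
isGenerator-complete (there (there (there (here refl)))) = tt
isGenerator-complete (there (there (there (there (here refl))))) = tt

data Constraint : Set where
  adjacent atMost atLeast below above : Constraint

holds : Constraint → V4 → V4 → Bool
holds adjacent s t = isGenerator (s ⊕ t)
holds atMost s t = not (value t <ᵇ value s)
holds atLeast s t = not (value s <ᵇ value t)
holds below s t = value s <ᵇ value t
holds above s t = value t <ᵇ value s

≤⇒≮ᵇ : ∀ {m n} → m ≤ n → T (not (n <ᵇ m))
≤⇒≮ᵇ {m} {n} m≤n with n <ᵇ m in eq
... | true = <⇒≱ (<ᵇ⇒< n m (subst T (sym eq) tt)) m≤n
... | false = tt

-- The rim of 𝟎: its seven neighbours e₁, …, e₆, 𝟏 in PC(6). Its values are required to be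
-- non-decreasing along the list and not all equal.
rim : List Idx
rim = map unit (allFin 6) ++ 𝟏 ∷ []

nondecreasing : List Idx → List (Idx × Idx × Constraint)
nondecreasing (a ∷ b ∷ xs) = (a , b , atMost) ∷ (b , a , atLeast) ∷ nondecreasing (b ∷ xs)
nondecreasing _ = []

orderArcs : List (Idx × Idx × Constraint)
orderArcs = (unit zero , 𝟏 , below) ∷ (𝟏 , unit zero , above) ∷ nondecreasing rim

flipArcs : Idx → List (Idx × Constraint)
flipArcs x = map (λ k → flipAt k x , adjacent) (allFin 6)

startsAt : ∀ x (a : Idx × Idx × Constraint) → Dec (x ≡ proj₁ a)
startsAt x a = ≡-dec Bool._≟_ x (proj₁ a)

arcs : Idx → List (Idx × Constraint)
arcs x = flipArcs x ++ (complement x , adjacent) ∷ map proj₂ (filter (startsAt x) orderArcs)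

open Refutation holds 6

network : Network
network = tabulateᵀ arcs

start : V4 → Domains
start r = updateᵀ (tabulateᵀ (λ _ → nonzero)) 𝟎 (r ∷ [])

certificate₁ certificate₂ : Certificate
certificate₁ =
  at 1 ((at 63 ((at 2 ((at 4 ((at 8 ((at 16 ((at 32 ((at 31 ((at 47 ((at 55 ((at 59 ((at 61 ((at 62
  ((at 3 (at 12 [] ∷ at 12 [] ∷ at 12 [] ∷ [])) ∷ at 6 [] ∷ [])) ∷ at 5 [] ∷ [])) ∷ at 3 [] ∷ [])) ∷
  at 3 [] ∷ [])) ∷ at 3 [] ∷ [])) ∷ (at 47 (at 3 [] ∷ (at 55 (at 3 [] ∷ (at 59 (at 3 [] ∷ (at 61 (at
  5 [] ∷ (at 62 (at 6 [] ∷ (at 3 (at 13 [] ∷ at 13 [] ∷ at 13 [] ∷ at 13 [] ∷ [])) ∷ [])) ∷ [])) ∷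
  [])) ∷ [])) ∷ [])) ∷ [])) ∷ at 35 [] ∷ [])) ∷ at 17 [] ∷ [])) ∷ at 9 [] ∷ [])) ∷ at 13 [] ∷ [])) ∷
  (at 3 ((at 5 ((at 9 ((at 17 ((at 33 ((at 62 ((at 6 (at 24 [] ∷ at 24 [] ∷ at 24 [] ∷ [])) ∷ at 6
  [] ∷ [])) ∷ at 6 [] ∷ [])) ∷ at 6 [] ∷ [])) ∷ at 6 [] ∷ [])) ∷ at 14 [] ∷ [])) ∷ (at 5 (at 14 [] ∷
  (at 9 (at 6 [] ∷ (at 17 (at 6 [] ∷ (at 33 (at 6 [] ∷ (at 62 (at 6 [] ∷ (at 6 (at 26 [] ∷ at 26 []
  ∷ at 26 [] ∷ at 26 [] ∷ [])) ∷ [])) ∷ [])) ∷ [])) ∷ [])) ∷ [])) ∷ [])) ∷ [])) ∷ (at 62 ((at 2 ((at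
  61 ((at 4 ((at 8 ((at 16 ((at 47 ((at 55 ((at 59 ((at 3 (at 12 [] ∷ at 12 [] ∷ at 12 [] ∷ [])) ∷
  at 3 [] ∷ [])) ∷ at 3 [] ∷ [])) ∷ at 3 [] ∷ [])) ∷ [])) ∷ [])) ∷ [])) ∷ at 12 [] ∷ [])) ∷ at 12 []
  ∷ (at 3 ((at 5 ((at 9 ((at 17 ((at 33 ((at 6 (at 24 [] ∷ at 24 [] ∷ at 24 [] ∷ [])) ∷ at 6 [] ∷
  [])) ∷ at 6 [] ∷ [])) ∷ at 6 [] ∷ [])) ∷ at 10 [] ∷ [])) ∷ at 12 [] ∷ [])) ∷ [])) ∷ (at 2 ((at 61
  (at 12 [] ∷ (at 4 ((at 59 (at 3 [] ∷ (at 8 ((at 55 (at 3 [] ∷ (at 16 ((at 47 (at 3 [] ∷ (at 32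
  ((at 31 (at 3 [] ∷ (at 3 (at 13 [] ∷ at 13 [] ∷ at 13 [] ∷ at 13 [] ∷ [])) ∷ [])) ∷ at 3 [] ∷ at 3
  [] ∷ [])) ∷ [])) ∷ at 3 [] ∷ [])) ∷ [])) ∷ at 3 [] ∷ [])) ∷ [])) ∷ at 5 [] ∷ [])) ∷ [])) ∷ at 12
  [] ∷ (at 3 (at 12 [] ∷ (at 5 (at 10 [] ∷ (at 9 (at 6 [] ∷ (at 17 (at 6 [] ∷ (at 33 (at 6 [] ∷ (at
  6 (at 26 [] ∷ at 26 [] ∷ at 26 [] ∷ at 26 [] ∷ [])) ∷ [])) ∷ [])) ∷ [])) ∷ [])) ∷ [])) ∷ [])) ∷
  [])) ∷ (at 62 ((at 2 ((at 61 ((at 4 ((at 59 ((at 8 ((at 55 ((at 16 ((at 47 ((at 3 (at 12 [] ∷ at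
  12 [] ∷ at 12 [] ∷ [])) ∷ at 3 [] ∷ [])) ∷ at 3 [] ∷ [])) ∷ at 3 [] ∷ [])) ∷ at 3 [] ∷ [])) ∷ at 9
  [] ∷ [])) ∷ at 8 [] ∷ [])) ∷ at 12 [] ∷ [])) ∷ at 12 [] ∷ at 12 [] ∷ (at 3 ((at 5 ((at 9 ((at 17
  ((at 33 ((at 6 (at 24 [] ∷ at 24 [] ∷ at 24 [] ∷ [])) ∷ at 6 [] ∷ [])) ∷ at 6 [] ∷ [])) ∷ at 6 []
  ∷ [])) ∷ at 10 [] ∷ [])) ∷ at 12 [] ∷ [])) ∷ [])) ∷ (at 2 ((at 61 (at 12 [] ∷ (at 4 ((at 59 (at 9
  [] ∷ (at 8 ((at 55 (at 3 [] ∷ (at 16 ((at 47 (at 3 [] ∷ (at 3 (at 13 [] ∷ at 13 [] ∷ at 13 [] ∷ at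
  13 [] ∷ [])) ∷ [])) ∷ at 3 [] ∷ at 3 [] ∷ [])) ∷ [])) ∷ at 3 [] ∷ at 3 [] ∷ [])) ∷ [])) ∷ at 9 []
  ∷ at 5 [] ∷ [])) ∷ [])) ∷ at 12 [] ∷ at 12 [] ∷ (at 3 (at 12 [] ∷ (at 5 (at 10 [] ∷ (at 9 (at 6 []
  ∷ (at 17 (at 6 [] ∷ (at 33 (at 6 [] ∷ (at 6 (at 26 [] ∷ at 26 [] ∷ at 26 [] ∷ at 26 [] ∷ [])) ∷
  [])) ∷ [])) ∷ [])) ∷ [])) ∷ [])) ∷ [])) ∷ [])) ∷ [])) ∷ (at 63 ((at 2 ((at 4 ((at 8 ((at 16 ((at
  32 ((at 31 ((at 47 ((at 55 ((at 59 ((at 61 ((at 62 ((at 3 (at 12 [] ∷ at 12 [] ∷ at 12 [] ∷ [])) ∷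
  at 6 [] ∷ [])) ∷ at 5 [] ∷ [])) ∷ at 3 [] ∷ [])) ∷ at 3 [] ∷ [])) ∷ at 3 [] ∷ [])) ∷ (at 47 (at 3
  [] ∷ (at 55 (at 3 [] ∷ (at 59 (at 3 [] ∷ (at 61 (at 5 [] ∷ (at 62 (at 6 [] ∷ (at 3 (at 13 [] ∷ at
  13 [] ∷ at 13 [] ∷ at 13 [] ∷ [])) ∷ [])) ∷ [])) ∷ [])) ∷ [])) ∷ [])) ∷ [])) ∷ at 35 [] ∷ [])) ∷
  at 17 [] ∷ [])) ∷ at 9 [] ∷ [])) ∷ at 13 [] ∷ [])) ∷ (at 3 ((at 5 ((at 9 ((at 17 ((at 33 ((at 62
  ((at 6 (at 24 [] ∷ at 24 [] ∷ at 24 [] ∷ [])) ∷ at 6 [] ∷ [])) ∷ at 6 [] ∷ [])) ∷ at 6 [] ∷ [])) ∷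
  at 6 [] ∷ [])) ∷ at 14 [] ∷ [])) ∷ (at 5 (at 14 [] ∷ (at 9 (at 6 [] ∷ (at 17 (at 6 [] ∷ (at 33 (at
  6 [] ∷ (at 62 (at 6 [] ∷ (at 6 (at 26 [] ∷ at 26 [] ∷ at 26 [] ∷ at 26 [] ∷ [])) ∷ [])) ∷ [])) ∷
  [])) ∷ [])) ∷ [])) ∷ [])) ∷ [])) ∷ (at 62 ((at 2 ((at 61 ((at 4 ((at 8 ((at 16 ((at 47 ((at 55
  ((at 59 ((at 3 (at 12 [] ∷ at 12 [] ∷ at 12 [] ∷ [])) ∷ at 3 [] ∷ [])) ∷ at 3 [] ∷ [])) ∷ at 3 []
  ∷ [])) ∷ [])) ∷ [])) ∷ [])) ∷ at 12 [] ∷ [])) ∷ at 12 [] ∷ (at 3 ((at 5 ((at 9 ((at 17 ((at 33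
  ((at 6 (at 24 [] ∷ at 24 [] ∷ at 24 [] ∷ [])) ∷ at 6 [] ∷ [])) ∷ at 6 [] ∷ [])) ∷ at 6 [] ∷ [])) ∷
  at 10 [] ∷ [])) ∷ at 12 [] ∷ [])) ∷ [])) ∷ (at 2 ((at 61 (at 12 [] ∷ (at 4 ((at 59 (at 3 [] ∷ (at
  8 ((at 55 (at 3 [] ∷ (at 16 ((at 47 (at 3 [] ∷ (at 32 ((at 31 (at 3 [] ∷ (at 3 (at 13 [] ∷ at 13
  [] ∷ at 13 [] ∷ at 13 [] ∷ [])) ∷ [])) ∷ at 3 [] ∷ at 3 [] ∷ [])) ∷ [])) ∷ at 3 [] ∷ [])) ∷ [])) ∷
  at 3 [] ∷ [])) ∷ [])) ∷ at 5 [] ∷ [])) ∷ [])) ∷ at 12 [] ∷ (at 3 (at 12 [] ∷ (at 5 (at 10 [] ∷ (at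
  9 (at 6 [] ∷ (at 17 (at 6 [] ∷ (at 33 (at 6 [] ∷ (at 6 (at 26 [] ∷ at 26 [] ∷ at 26 [] ∷ at 26 []
  ∷ [])) ∷ [])) ∷ [])) ∷ [])) ∷ [])) ∷ [])) ∷ [])) ∷ [])) ∷ [])) ∷ (at 2 ((at 4 ((at 8 ((at 16 ((at
  32 ((at 31 ((at 47 ((at 55 ((at 59 ((at 61 ((at 62 ((at 3 (at 12 [] ∷ at 12 [] ∷ at 12 [] ∷ [])) ∷
  at 6 [] ∷ [])) ∷ at 5 [] ∷ [])) ∷ at 3 [] ∷ [])) ∷ at 3 [] ∷ [])) ∷ at 3 [] ∷ [])) ∷ (at 47 (at 3
  [] ∷ (at 55 (at 3 [] ∷ (at 59 (at 3 [] ∷ (at 61 (at 5 [] ∷ (at 62 (at 6 [] ∷ (at 3 (at 13 [] ∷ at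
  13 [] ∷ at 13 [] ∷ at 13 [] ∷ [])) ∷ [])) ∷ [])) ∷ [])) ∷ [])) ∷ [])) ∷ [])) ∷ at 35 [] ∷ [])) ∷
  at 17 [] ∷ [])) ∷ at 9 [] ∷ [])) ∷ at 13 [] ∷ [])) ∷ (at 3 ((at 5 ((at 9 ((at 17 ((at 33 ((at 62
  ((at 6 (at 24 [] ∷ at 24 [] ∷ at 24 [] ∷ [])) ∷ at 6 [] ∷ [])) ∷ at 6 [] ∷ [])) ∷ at 6 [] ∷ [])) ∷
  at 6 [] ∷ [])) ∷ at 14 [] ∷ [])) ∷ (at 5 (at 14 [] ∷ (at 9 (at 6 [] ∷ (at 17 (at 6 [] ∷ (at 33 (at
  6 [] ∷ (at 62 (at 6 [] ∷ (at 6 (at 26 [] ∷ at 26 [] ∷ at 26 [] ∷ at 26 [] ∷ [])) ∷ [])) ∷ [])) ∷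
  [])) ∷ [])) ∷ [])) ∷ [])) ∷ [])) ∷ [])
certificate₂ =
  at 1 ((at 3 ((at 5 ((at 9 ((at 17 ((at 33 ((at 62 ((at 63 ((at 6 (at 24 [] ∷ at 24 [] ∷ at 24 [] ∷
  [])) ∷ (at 2 (at 12 [] ∷ at 12 [] ∷ (at 6 (at 26 [] ∷ at 26 [] ∷ at 26 [] ∷ at 26 [] ∷ [])) ∷ []))
  ∷ (at 2 (at 12 [] ∷ at 12 [] ∷ at 12 [] ∷ (at 6 (at 26 [] ∷ at 26 [] ∷ at 26 [] ∷ at 26 [] ∷ []))
  ∷ [])) ∷ (at 7 (at 27 [] ∷ at 27 [] ∷ (at 10 (at 20 [] ∷ [])) ∷ (at 10 (at 20 [] ∷ [])) ∷ [])) ∷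
  [])) ∷ at 6 [] ∷ (at 30 (at 6 [] ∷ (at 46 ((at 54 ((at 58 ((at 60 ((at 6 (at 7 [] ∷ at 7 [] ∷ []))
  ∷ [])) ∷ [])) ∷ [])) ∷ [])) ∷ [])) ∷ (at 30 (at 6 [] ∷ (at 46 ((at 54 ((at 58 ((at 60 (at 4 [] ∷
  (at 2 (at 12 [] ∷ at 12 [] ∷ at 6 [] ∷ at 6 [] ∷ [])) ∷ [])) ∷ [])) ∷ [])) ∷ [])) ∷ [])) ∷ [])) ∷
  at 6 [] ∷ at 47 [] ∷ at 6 [] ∷ [])) ∷ at 6 [] ∷ at 34 [] ∷ at 6 [] ∷ [])) ∷ at 20 [] ∷ at 20 [] ∷
  at 18 [] ∷ [])) ∷ (at 4 (at 24 [] ∷ at 24 [] ∷ [])) ∷ (at 4 (at 24 [] ∷ at 14 [] ∷ [])) ∷ (at 63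
  (at 14 [] ∷ [])) ∷ [])) ∷ (at 2 ((at 5 ((at 7 ((at 17 ((at 19 ((at 9 ((at 11 ((at 33 ((at 35 ((at
  62 ((at 60 ((at 4 (at 20 [] ∷ at 12 [] ∷ at 12 [] ∷ [])) ∷ [])) ∷ at 4 [] ∷ [])) ∷ [])) ∷ [])) ∷
  [])) ∷ [])) ∷ [])) ∷ [])) ∷ at 24 [] ∷ [])) ∷ (at 4 ((at 10 (at 20 [] ∷ at 22 [] ∷ at 22 [] ∷ []))
  ∷ at 25 [] ∷ [])) ∷ at 25 [] ∷ at 25 [] ∷ [])) ∷ (at 4 ((at 5 (at 24 [] ∷ (at 8 ((at 9 (at 18 [] ∷
  (at 16 ((at 17 (at 6 [] ∷ (at 32 ((at 33 (at 6 [] ∷ (at 63 ((at 62 (at 6 [] ∷ (at 6 (at 26 [] ∷ at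
  26 [] ∷ at 26 [] ∷ at 26 [] ∷ [])) ∷ [])) ∷ at 6 [] ∷ at 6 [] ∷ [])) ∷ [])) ∷ at 6 [] ∷ at 6 [] ∷
  [])) ∷ [])) ∷ at 6 [] ∷ at 6 [] ∷ [])) ∷ [])) ∷ at 18 [] ∷ at 10 [] ∷ [])) ∷ [])) ∷ (at 8 ((at 16
  ((at 32 ((at 63 ((at 12 (at 5 [] ∷ [])) ∷ [])) ∷ [])) ∷ [])) ∷ [])) ∷ (at 12 (at 5 [] ∷ [])) ∷
  [])) ∷ [])) ∷ (at 2 ((at 5 ((at 7 ((at 17 ((at 19 ((at 9 ((at 11 ((at 33 ((at 35 ((at 62 ((at 60
  ((at 4 (at 20 [] ∷ at 12 [] ∷ at 12 [] ∷ [])) ∷ [])) ∷ at 4 [] ∷ [])) ∷ [])) ∷ [])) ∷ [])) ∷ []))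
  ∷ [])) ∷ [])) ∷ at 24 [] ∷ [])) ∷ at 25 [] ∷ (at 4 ((at 10 (at 20 [] ∷ at 22 [] ∷ at 22 [] ∷ []))
  ∷ at 12 [] ∷ [])) ∷ at 25 [] ∷ [])) ∷ (at 4 ((at 5 (at 14 [] ∷ (at 8 ((at 9 (at 6 [] ∷ (at 16 ((at
  17 (at 6 [] ∷ (at 32 ((at 33 (at 6 [] ∷ (at 63 ((at 62 (at 6 [] ∷ (at 6 (at 26 [] ∷ at 26 [] ∷ at
  26 [] ∷ at 26 [] ∷ [])) ∷ [])) ∷ at 6 [] ∷ [])) ∷ [])) ∷ at 6 [] ∷ [])) ∷ [])) ∷ at 6 [] ∷ [])) ∷
  [])) ∷ at 10 [] ∷ [])) ∷ [])) ∷ (at 12 (at 5 [] ∷ [])) ∷ [])) ∷ [])) ∷ (at 2 ((at 5 ((at 7 ((at 17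
  ((at 19 ((at 9 ((at 11 ((at 33 ((at 35 ((at 62 ((at 60 ((at 4 (at 20 [] ∷ at 12 [] ∷ at 12 [] ∷
  [])) ∷ at 4 [] ∷ [])) ∷ at 4 [] ∷ [])) ∷ [])) ∷ [])) ∷ [])) ∷ [])) ∷ [])) ∷ [])) ∷ at 24 [] ∷ []))
  ∷ at 25 [] ∷ at 25 [] ∷ (at 4 ((at 10 (at 20 [] ∷ at 22 [] ∷ at 22 [] ∷ [])) ∷ at 12 [] ∷ [])) ∷
  [])) ∷ (at 5 (at 14 [] ∷ (at 9 (at 6 [] ∷ (at 17 (at 6 [] ∷ (at 33 (at 6 [] ∷ (at 62 (at 6 [] ∷
  (at 6 (at 26 [] ∷ at 26 [] ∷ at 26 [] ∷ at 26 [] ∷ [])) ∷ [])) ∷ [])) ∷ [])) ∷ [])) ∷ [])) ∷ []))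
  ∷ [])) ∷ (at 63 ((at 2 ((at 4 ((at 8 ((at 16 ((at 32 ((at 31 ((at 47 ((at 55 ((at 59 ((at 61 ((at
  62 ((at 3 (at 12 [] ∷ at 12 [] ∷ at 12 [] ∷ [])) ∷ at 6 [] ∷ [])) ∷ at 5 [] ∷ [])) ∷ at 3 [] ∷
  [])) ∷ at 3 [] ∷ [])) ∷ at 3 [] ∷ [])) ∷ (at 47 (at 3 [] ∷ (at 55 (at 3 [] ∷ (at 59 (at 3 [] ∷ (at
  61 (at 5 [] ∷ (at 62 (at 6 [] ∷ (at 3 (at 12 [] ∷ at 12 [] ∷ at 12 [] ∷ [])) ∷ [])) ∷ [])) ∷ []))
  ∷ [])) ∷ [])) ∷ [])) ∷ at 35 [] ∷ [])) ∷ at 17 [] ∷ [])) ∷ at 9 [] ∷ [])) ∷ at 13 [] ∷ [])) ∷ (at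
  3 ((at 5 ((at 9 ((at 17 ((at 33 ((at 62 ((at 6 (at 26 [] ∷ at 26 [] ∷ at 26 [] ∷ at 26 [] ∷ [])) ∷
  at 6 [] ∷ [])) ∷ at 6 [] ∷ [])) ∷ at 6 [] ∷ [])) ∷ at 6 [] ∷ [])) ∷ at 14 [] ∷ [])) ∷ (at 5 (at 14
  [] ∷ (at 9 (at 6 [] ∷ (at 17 (at 6 [] ∷ (at 33 (at 6 [] ∷ (at 62 (at 6 [] ∷ (at 6 (at 26 [] ∷ at
  26 [] ∷ at 26 [] ∷ at 26 [] ∷ [])) ∷ [])) ∷ [])) ∷ [])) ∷ [])) ∷ [])) ∷ [])) ∷ [])) ∷ (at 62 ((at
  2 ((at 61 ((at 4 ((at 8 ((at 16 ((at 47 ((at 55 ((at 59 ((at 3 (at 12 [] ∷ at 12 [] ∷ at 12 [] ∷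
  [])) ∷ at 3 [] ∷ [])) ∷ at 3 [] ∷ [])) ∷ at 3 [] ∷ [])) ∷ [])) ∷ [])) ∷ [])) ∷ at 12 [] ∷ [])) ∷
  at 12 [] ∷ (at 3 ((at 5 ((at 9 ((at 17 ((at 33 ((at 6 (at 26 [] ∷ at 26 [] ∷ at 26 [] ∷ at 26 [] ∷
  [])) ∷ at 6 [] ∷ [])) ∷ at 6 [] ∷ [])) ∷ at 6 [] ∷ [])) ∷ at 10 [] ∷ [])) ∷ at 12 [] ∷ [])) ∷ []))
  ∷ (at 2 ((at 61 (at 12 [] ∷ (at 4 ((at 59 (at 7 [] ∷ (at 8 ((at 55 (at 3 [] ∷ (at 16 ((at 47 (at 3
  [] ∷ (at 3 (at 12 [] ∷ at 12 [] ∷ at 12 [] ∷ [])) ∷ [])) ∷ at 17 [] ∷ [])) ∷ [])) ∷ at 9 [] ∷ []))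
  ∷ [])) ∷ at 5 [] ∷ [])) ∷ [])) ∷ (at 12 (at 5 [] ∷ [])) ∷ (at 3 (at 12 [] ∷ (at 5 (at 10 [] ∷ (at
  9 (at 6 [] ∷ (at 17 (at 6 [] ∷ (at 33 (at 6 [] ∷ (at 6 (at 26 [] ∷ at 26 [] ∷ at 26 [] ∷ at 26 []
  ∷ [])) ∷ [])) ∷ [])) ∷ [])) ∷ [])) ∷ [])) ∷ [])) ∷ [])) ∷ (at 62 ((at 2 ((at 61 ((at 4 ((at 59
  ((at 8 ((at 55 ((at 16 ((at 47 ((at 3 (at 12 [] ∷ at 12 [] ∷ at 12 [] ∷ [])) ∷ at 3 [] ∷ [])) ∷ at
  3 [] ∷ [])) ∷ at 3 [] ∷ [])) ∷ at 3 [] ∷ [])) ∷ at 9 [] ∷ [])) ∷ at 8 [] ∷ [])) ∷ at 12 [] ∷ []))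
  ∷ at 12 [] ∷ at 12 [] ∷ (at 3 ((at 5 ((at 9 ((at 17 ((at 33 ((at 6 (at 26 [] ∷ at 26 [] ∷ at 26 []
  ∷ at 26 [] ∷ [])) ∷ at 6 [] ∷ [])) ∷ at 6 [] ∷ [])) ∷ at 6 [] ∷ [])) ∷ at 10 [] ∷ [])) ∷ at 12 []
  ∷ [])) ∷ [])) ∷ (at 2 ((at 61 (at 12 [] ∷ (at 5 (at 15 [] ∷ at 11 [] ∷ at 11 [] ∷ [])) ∷ [])) ∷
  (at 12 (at 5 [] ∷ [])) ∷ (at 12 (at 5 [] ∷ [])) ∷ (at 3 (at 12 [] ∷ (at 5 (at 10 [] ∷ (at 9 (at 6
  [] ∷ (at 17 (at 6 [] ∷ (at 33 (at 6 [] ∷ (at 6 (at 26 [] ∷ at 26 [] ∷ at 26 [] ∷ at 26 [] ∷ [])) ∷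
  [])) ∷ [])) ∷ [])) ∷ [])) ∷ [])) ∷ [])) ∷ [])) ∷ [])) ∷ (at 63 ((at 2 ((at 4 ((at 8 ((at 16 ((at
  32 ((at 31 ((at 47 ((at 55 ((at 59 ((at 61 ((at 62 ((at 3 (at 13 [] ∷ at 13 [] ∷ at 13 [] ∷ at 13
  [] ∷ [])) ∷ at 6 [] ∷ [])) ∷ at 5 [] ∷ [])) ∷ at 3 [] ∷ [])) ∷ at 3 [] ∷ [])) ∷ at 3 [] ∷ [])) ∷
  (at 47 (at 3 [] ∷ (at 55 (at 3 [] ∷ (at 59 (at 3 [] ∷ (at 61 (at 5 [] ∷ (at 62 (at 6 [] ∷ (at 3
  (at 12 [] ∷ at 12 [] ∷ at 12 [] ∷ [])) ∷ [])) ∷ [])) ∷ [])) ∷ [])) ∷ [])) ∷ [])) ∷ at 35 [] ∷ []))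
  ∷ at 17 [] ∷ [])) ∷ at 9 [] ∷ [])) ∷ at 13 [] ∷ [])) ∷ (at 3 ((at 5 ((at 9 ((at 17 ((at 33 ((at 62
  ((at 6 (at 26 [] ∷ at 26 [] ∷ at 26 [] ∷ at 26 [] ∷ [])) ∷ at 6 [] ∷ [])) ∷ at 6 [] ∷ [])) ∷ at 6
  [] ∷ [])) ∷ at 6 [] ∷ [])) ∷ at 14 [] ∷ [])) ∷ (at 5 (at 14 [] ∷ (at 9 (at 6 [] ∷ (at 17 (at 6 []
  ∷ (at 33 (at 6 [] ∷ (at 62 (at 6 [] ∷ (at 6 (at 24 [] ∷ at 24 [] ∷ at 24 [] ∷ [])) ∷ [])) ∷ [])) ∷
  [])) ∷ [])) ∷ [])) ∷ [])) ∷ [])) ∷ (at 62 ((at 2 ((at 61 ((at 4 ((at 8 ((at 16 ((at 47 ((at 55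
  ((at 59 ((at 32 ((at 31 ((at 3 (at 13 [] ∷ at 13 [] ∷ at 13 [] ∷ at 13 [] ∷ [])) ∷ at 3 [] ∷ []))
  ∷ at 3 [] ∷ at 3 [] ∷ [])) ∷ at 3 [] ∷ [])) ∷ at 3 [] ∷ [])) ∷ at 3 [] ∷ [])) ∷ [])) ∷ [])) ∷ []))
  ∷ at 12 [] ∷ [])) ∷ at 12 [] ∷ (at 3 ((at 5 ((at 9 ((at 17 ((at 33 ((at 6 (at 26 [] ∷ at 26 [] ∷
  at 26 [] ∷ at 26 [] ∷ [])) ∷ at 6 [] ∷ [])) ∷ at 6 [] ∷ [])) ∷ at 6 [] ∷ [])) ∷ at 10 [] ∷ [])) ∷
  at 12 [] ∷ [])) ∷ [])) ∷ (at 2 ((at 61 (at 12 [] ∷ (at 4 ((at 8 ((at 16 ((at 47 (at 3 [] ∷ (at 55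
  (at 3 [] ∷ (at 59 (at 3 [] ∷ (at 3 (at 12 [] ∷ at 12 [] ∷ at 12 [] ∷ [])) ∷ [])) ∷ [])) ∷ [])) ∷
  [])) ∷ [])) ∷ [])) ∷ [])) ∷ at 12 [] ∷ (at 3 (at 12 [] ∷ (at 5 (at 10 [] ∷ (at 9 (at 6 [] ∷ (at 17
  (at 6 [] ∷ (at 33 (at 6 [] ∷ (at 6 (at 24 [] ∷ at 24 [] ∷ at 24 [] ∷ [])) ∷ [])) ∷ [])) ∷ [])) ∷
  [])) ∷ [])) ∷ [])) ∷ [])) ∷ [])) ∷ (at 2 ((at 4 ((at 8 ((at 16 ((at 32 ((at 31 ((at 47 ((at 55
  ((at 59 ((at 61 ((at 62 ((at 3 (at 13 [] ∷ at 13 [] ∷ at 13 [] ∷ at 13 [] ∷ [])) ∷ at 6 [] ∷ []))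
  ∷ at 5 [] ∷ [])) ∷ at 3 [] ∷ [])) ∷ at 3 [] ∷ [])) ∷ at 3 [] ∷ [])) ∷ (at 47 (at 3 [] ∷ (at 55 (at
  3 [] ∷ (at 59 (at 3 [] ∷ (at 61 (at 5 [] ∷ (at 62 (at 6 [] ∷ (at 3 (at 12 [] ∷ at 12 [] ∷ at 12 []
  ∷ [])) ∷ [])) ∷ [])) ∷ [])) ∷ [])) ∷ [])) ∷ [])) ∷ at 35 [] ∷ [])) ∷ at 17 [] ∷ [])) ∷ at 9 [] ∷
  [])) ∷ at 13 [] ∷ [])) ∷ (at 3 ((at 5 ((at 9 ((at 17 ((at 33 ((at 62 ((at 6 (at 26 [] ∷ at 26 [] ∷
  at 26 [] ∷ at 26 [] ∷ [])) ∷ at 6 [] ∷ [])) ∷ at 6 [] ∷ [])) ∷ at 6 [] ∷ [])) ∷ at 6 [] ∷ [])) ∷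
  at 14 [] ∷ [])) ∷ (at 5 (at 14 [] ∷ (at 9 (at 6 [] ∷ (at 17 (at 6 [] ∷ (at 33 (at 6 [] ∷ (at 62
  (at 6 [] ∷ (at 6 (at 24 [] ∷ at 24 [] ∷ at 24 [] ∷ [])) ∷ [])) ∷ [])) ∷ [])) ∷ [])) ∷ [])) ∷ []))
  ∷ [])) ∷ [])

certificate₁-valid : refuted network (start e₁) certificate₁ ≡ true
certificate₁-valid = refl

certificate₂-valid : refuted network (start (e₁ ⊕ e₂)) certificate₂ ≡ true
certificate₂-valid = refl

module _ (h : Idx → V4) where

  open Soundness network h

  HoldsAt : Idx × Idx × Constraint → Set
  HoldsAt (a , b , r) = T (holds r (h a) (h b))

  ArcHolds : Idx → Idx × Constraint → Set
  ArcHolds x a = T (holds (proj₂ a) (h x) (h (proj₁ a)))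

  nondecreasing-holds : ∀ xs → Linked (λ a b → value (h a) ≤ value (h b)) xs → All HoldsAt (nondecreasing xs)
  nondecreasing-holds [] _ = []
  nondecreasing-holds (a ∷ []) _ = []
  nondecreasing-holds (a ∷ b ∷ xs) (a≤b ∷ rest) = ≤⇒≮ᵇ a≤b ∷ ≤⇒≮ᵇ a≤b ∷ nondecreasing-holds (b ∷ xs) rest

  arcs-hold : IsPCHom PC4Adj h → All HoldsAt orderArcs → ∀ x → All (ArcHolds x) (arcs x)
  arcs-hold hom orders x =
    ++⁺ {xs = flipArcs x}
      (map⁺ {f = λ k → flipAt k x , adjacent}
        (All.tabulate (λ _ → isGenerator-complete (IsPCHom.along-flip hom x _))))
      (isGenerator-complete (IsPCHom.along-complement hom x) ∷ map⁺ {f = proj₂} from-x)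
    where
    from-x : All (ArcHolds x ∘ proj₂) (filter (startsAt x) orderArcs)
    from-x = All.map (λ { (refl , holds) → holds })
                     (All.zip (all-filter (startsAt x) orderArcs , filter⁺ (startsAt x) orders))

  satisfies : IsPCHom PC4Adj h → Linked (λ a b → value (h a) ≤ value (h b)) rim →
    value (h (unit zero)) < value (h 𝟏) → Satisfies
  satisfies hom sorted strict x =
    subst (All (ArcHolds x)) (sym (lookup-tabulate arcs x))
      (arcs-hold hom (<⇒<ᵇ strict ∷ <⇒<ᵇ strict ∷ nondecreasing-holds rim sorted) x)

  admits-start : (∀ i → h i ≢ 𝟎) → Admits (start (h 𝟎))
  admits-start avoids = admits-update (tabulateᵀ (λ _ → nonzero)) 𝟎 (h 𝟎 ∷ []) everywhere (here refl)
    where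
    everywhere : Admits (tabulateᵀ (λ _ → nonzero))
    everywhere x = subst (h x ∈_) (sym (lookup-tabulate (λ _ → nonzero) x)) (∈-nonzero (h x) (avoids x))

  valid-at-root : ∀ {r c} → r ≡ h 𝟎 → refuted network (start r) c ≡ true → T (refuted network (start (h 𝟎)) c)
  valid-at-root refl ok = subst T (sym ok) tt

  no-avoiding-hom : IsPCHom PC4Adj h → (∀ i → h i ≢ 𝟎) → Canonical (h 𝟎) →
    Linked (λ a b → value (h a) ≤ value (h b)) rim → value (h (unit zero)) < value (h 𝟏) → ⊥
  no-avoiding-hom hom avoids (inj₁ root≡e₁) sorted strict =
    refuted-sound (satisfies hom sorted strict) (start (h 𝟎)) certificate₁ (admits-start avoids)
      (valid-at-root {r = e₁} {c = certificate₁} (sym root≡e₁) certificate₁-valid)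
  no-avoiding-hom hom avoids (inj₂ root≡e₁₂) sorted strict =
    refuted-sound (satisfies hom sorted strict) (start (h 𝟎)) certificate₂ (admits-start avoids)
      (valid-at-root {r = e₁ ⊕ e₂} {c = certificate₂} (sym root≡e₁₂) certificate₂-valid)

module _ {A : Set} (key : A → ℕ) where

  private
    _≤ᵏ_ : A → A → Set
    a ≤ᵏ b = key a ≤ key b

  below-last : ∀ xs z → Linked _≤ᵏ_ (xs ++ z ∷ []) → All (_≤ᵏ z) (xs ++ z ∷ [])
  below-last [] z _ = ≤-refl ∷ []
  below-last (x ∷ []) z (x≤z ∷ _) = x≤z ∷ ≤-refl ∷ []
  below-last (x ∷ y ∷ ys) z (x≤y ∷ sorted) with below-last (y ∷ ys) z sorted
  ... | y≤z ∷ rest = ≤-trans x≤y y≤z ∷ y≤z ∷ rest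

  sorted-constant : ∀ x xs z → Linked _≤ᵏ_ (x ∷ xs ++ z ∷ []) → key x ≡ key z →
    All (λ a → key a ≡ key x) (x ∷ xs ++ z ∷ [])
  sorted-constant x xs z sorted x≡z =
    All.zipWith (λ { {a} (x≤a , a≤z) → ≤-antisym (subst (key a ≤_) (sym x≡z) a≤z) x≤a })
      (Linked⇒All {R = _≤ᵏ_} ≤-trans {v = x} ≤-refl sorted , below-last (x ∷ xs) z sorted)

seven : ∀ {A : Set} (xs : List A) → length xs ≡ 7 → ∃ λ (v : Vec A 7) → xs ≡ toList v
seven (a ∷ b ∷ c ∷ d ∷ e ∷ f ∷ g ∷ []) refl = (a ∷ b ∷ c ∷ d ∷ e ∷ f ∷ g ∷ []) , refl
seven [] ()
seven (_ ∷ []) ()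
seven (_ ∷ _ ∷ []) ()
seven (_ ∷ _ ∷ _ ∷ []) ()
seven (_ ∷ _ ∷ _ ∷ _ ∷ []) ()
seven (_ ∷ _ ∷ _ ∷ _ ∷ _ ∷ []) ()
seven (_ ∷ _ ∷ _ ∷ _ ∷ _ ∷ _ ∷ []) ()
seven (_ ∷ _ ∷ _ ∷ _ ∷ _ ∷ _ ∷ _ ∷ _ ∷ _) ()

module Cube {Γ : Set} {_+_ : Op₂ Γ} {0# : Γ} { -_ : Op₁ Γ}
  (isGroup : IsGroup _≡_ _+_ 0# -_) (self-inverse : ∀ x → x + x ≡ 0#) (Ω : Γ → Set) where

  open IsGroup isGroup using (assoc; identityˡ; identityʳ)
  open Exponent2 isGroup self-inverse
  open ≡-Reasoning

  Cay : Γ → Γ → Set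
  Cay = CayAdj _+_ -_ Ω

  -- As - v = v, u ~ v iff u + v ∈ Ω.
  step : ∀ u w → Ω w → Cay u (u + w)
  step u w ω = subst Ω (sym (trans (cong (u +_) (neg (u + w))) (cancelˡ u w))) ω

  label : ∀ {u v} → Cay u v → Ω (u + v)
  label {u} {v} = subst Ω (cong (u +_) (neg v))

  Σ⟨_⟩ : List Γ → Γ
  Σ⟨_⟩ = foldr _+_ 0#

  -- Σ⟨ s₀ … s₆ ⟩ ≡ 0# turns into s₆ ≡ s₀ + … + s₅ via Σ-++.
  Σ-++ : ∀ xs z → Σ⟨ xs ++ z ∷ [] ⟩ ≡ Σ⟨ xs ⟩ + z
  Σ-++ [] z = trans (identityʳ z) (sym (identityˡ z))
  Σ-++ (x ∷ xs) z = trans (cong (x +_) (Σ-++ xs z)) (sym (assoc x Σ⟨ xs ⟩ z))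

  infixr 30 _·_
  _·_ : Bool → Γ → Γ
  true · w = w
  false · w = 0#

  combination : ∀ {n} → Vec Γ n → Vec Bool n → Γ
  combination [] [] = 0#
  combination (w ∷ ws) (b ∷ i) = b · w + combination ws i

  total : ∀ {n} → Vec Γ n → Γ
  total [] = 0#
  total (w ∷ ws) = w + total ws

  not-· : ∀ b w → not b · w ≡ b · w + w
  not-· false w = sym (identityˡ w)
  not-· true w = sym (self-inverse w)

  combination-flip : ∀ {n} (ws : Vec Γ n) i k → combination ws (flipAt k i) ≡ combination ws i + lookup ws k
  combination-flip (w ∷ ws) (b ∷ i) zero = begin
    not b · w + combination ws i   ≡⟨ cong (_+ combination ws i) (not-· b w) ⟩
    (b · w + w) + combination ws i ≡⟨ assoc (b · w) w _ ⟩
    b · w + (w + combination ws i) ≡⟨ cong (b · w +_) (comm w _) ⟩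
    b · w + (combination ws i + w) ≡⟨ assoc (b · w) _ w ⟨
    (b · w + combination ws i) + w ∎
  combination-flip (w ∷ ws) (b ∷ i) (suc k) = begin
    b · w + combination ws (flipAt k i)      ≡⟨ cong (b · w +_) (combination-flip ws i k) ⟩
    b · w + (combination ws i + lookup ws k) ≡⟨ assoc (b · w) _ _ ⟨
    (b · w + combination ws i) + lookup ws k ∎

  combination-complement : ∀ {n} (ws : Vec Γ n) i → combination ws (complement i) ≡ combination ws i + total ws
  combination-complement [] [] = sym (identityʳ 0#)
  combination-complement (w ∷ ws) (b ∷ i) = begin
    not b · w + combination ws (complement i)   ≡⟨ cong₂ _+_ (not-· b w) (combination-complement ws i) ⟩
    (b · w + w) + (combination ws i + total ws) ≡⟨ interchange (b · w) w _ _ ⟩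
    (b · w + combination ws i) + (w + total ws) ∎

  combination-𝟎 : ∀ {n} (ws : Vec Γ n) → combination ws 𝟎 ≡ 0#
  combination-𝟎 [] = refl
  combination-𝟎 (w ∷ ws) = trans (identityˡ _) (combination-𝟎 ws)

  -- The cube map i ↦ x + Σₖ iₖ wₖ: flipping coordinate k adds wₖ, complementing adds the
  -- total, so it is a homomorphism PC(n) → Cay(Γ, Ω) when the wₖ and their total lie in Ω.
  cubeMap : ∀ {n} → Γ → Vec Γ n → Vec Bool n → Γ
  cubeMap x ws i = x + combination ws i

  cubeMap-shift : ∀ {n} x (ws : Vec Γ n) {i j} w → combination ws j ≡ combination ws i + w →
    cubeMap x ws j ≡ cubeMap x ws i + w
  cubeMap-shift x ws {i} w eq = trans (cong (x +_) eq) (sym (assoc x (combination ws i) w))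

  cubeMap-hom : ∀ {n} x (ws : Vec Γ n) → (∀ k → Ω (lookup ws k)) → Ω (total ws) → IsPCHom Cay (cubeMap x ws)
  cubeMap-hom x ws ω ω-total = record
    { along-flip = λ i k →
        subst (Cay (cubeMap x ws i)) (sym (cubeMap-shift x ws _ (combination-flip ws i k))) (step _ _ (ω k))
    ; along-complement = λ i →
        subst (Cay (cubeMap x ws i)) (sym (cubeMap-shift x ws _ (combination-complement ws i))) (step _ _ ω-total) }

  cubeMap-𝟎 : ∀ {n} x (ws : Vec Γ n) → cubeMap x ws 𝟎 ≡ x
  cubeMap-𝟎 x ws = trans (cong (x +_) (combination-𝟎 ws)) (identityʳ x)

  cubeMap-unit : ∀ {n} x (ws : Vec Γ n) k → cubeMap x ws (unit k) ≡ x + lookup ws k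
  cubeMap-unit x ws k =
    trans (cubeMap-shift x ws _ (combination-flip ws 𝟎 k)) (cong (_+ lookup ws k) (cubeMap-𝟎 x ws))

  cubeMap-𝟏 : ∀ {n} x (ws : Vec Γ n) → cubeMap x ws 𝟏 ≡ x + total ws
  cubeMap-𝟏 x ws =
    trans (cubeMap-shift x ws _ (combination-complement ws 𝟎)) (cong (_+ total ws) (cubeMap-𝟎 x ws))

module Surjectivity {Γ : Set} {_+_ : Op₂ Γ} {0# : Γ} { -_ : Op₁ Γ}
  (isGroup : IsGroup _≡_ _+_ 0# -_) (self-inverse : ∀ x → x + x ≡ 0#) (Ω : Γ → Set)
  (f : Γ → V4) (f-hom : IsHom (CayAdj _+_ -_ Ω) PC4Adj f) (y : V4) where

  open IsGroup isGroup using (assoc; identityʳ)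
  open Exponent2 isGroup self-inverse
  open Cube isGroup self-inverse Ω
  open PermutationProperties (setoid Γ) using (foldr-commMonoid)
  open ≡-Reasoning

  Hits : Set
  Hits = ∃ λ x → f x ≡ y

  record Frame : Set where
    field
      centre : Γ
      spokes : List Γ
      seven-spokes : length spokes ≡ 7
      spokes-in-Ω : All Ω spokes
      spokes-sum : Σ⟨ spokes ⟩ ≡ 0#
      a b : Γ
      a-spoke : a ∈ spokes
      b-spoke : b ∈ spokes
      separated : f (centre + a) ≢ f (centre + b)

  -- Seen from a centre c with f c ≠ y, relabel PC(4) by the automorphism v ↦ N (v + y), which
  -- sends y to 𝟎 and f c to e₁ or e₁ + e₂; spokes w are keyed by the relabelled f (c + w).
  module Relabel (c : Γ) (fc≢y : f c ≢ y) where

    u≢𝟎 : f c ⊕ y ≢ 𝟎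
    u≢𝟎 eq = fc≢y (ℤ₂ⁿ.sum-zero⇒≡ (f c) y eq)

    open Normaliser (f c ⊕ y) u≢𝟎

    relabel : Γ → V4
    relabel x = N (f x ⊕ y)

    relabel-hom : ∀ {a b} → Cay a b → PC4Adj (relabel a) (relabel b)
    relabel-hom {a} {b} e = adj (translate-adj y (f-hom a b e))

    relabel-𝟎 : ∀ x → relabel x ≡ 𝟎 → f x ≡ y
    relabel-𝟎 x eq = ℤ₂ⁿ.sum-zero⇒≡ (f x) y (injective (f x ⊕ y) 𝟎 (trans eq (sym N-𝟎)))

    relabel-injective : ∀ a b → relabel a ≡ relabel b → f a ≡ f b
    relabel-injective a b eq = begin
      f a           ≡⟨ ℤ₂ⁿ.cancelʳ (f a) y ⟨
      (f a ⊕ y) ⊕ y ≡⟨ cong (_⊕ y) (injective (f a ⊕ y) (f b ⊕ y) eq) ⟩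
      (f b ⊕ y) ⊕ y ≡⟨ ℤ₂ⁿ.cancelʳ (f b) y ⟩
      f b           ∎

    key : Γ → ℕ
    key w = value (relabel (c + w))

    -- Seven spokes sorted by key, not all of the same key: the relabelled cube map they span
    -- at c satisfies every hypothesis of no-avoiding-hom except avoiding 𝟎, so it meets f⁻¹(y).
    module SortedSpokes (s₀ s₁ s₂ s₃ s₄ s₅ s₆ : Γ)
      (ω : All Ω (s₀ ∷ s₁ ∷ s₂ ∷ s₃ ∷ s₄ ∷ s₅ ∷ s₆ ∷ []))
      (sum-zero : Σ⟨ s₀ ∷ s₁ ∷ s₂ ∷ s₃ ∷ s₄ ∷ s₅ ∷ s₆ ∷ [] ⟩ ≡ 0#)
      (sorted : Linked (λ a b → key a ≤ key b) (s₀ ∷ s₁ ∷ s₂ ∷ s₃ ∷ s₄ ∷ s₅ ∷ s₆ ∷ []))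
      (strict : key s₀ < key s₆) where

      ws : Vec Γ 6
      ws = s₀ ∷ s₁ ∷ s₂ ∷ s₃ ∷ s₄ ∷ s₅ ∷ []

      total≡s₆ : total ws ≡ s₆
      total≡s₆ = sum-zero⇒≡ (total ws) s₆ (trans (sym (Σ-++ (toList ws) s₆)) sum-zero)

      h : Idx → V4
      h = relabel ∘ cubeMap c ws

      hom : IsPCHom PC4Adj h
      hom = ∘-IsPCHom (cubeMap-hom c ws (lookup⁺ (first-six ω)) (subst Ω (sym total≡s₆) (last ω))) relabel-hom
        where
        first-six : All Ω (s₀ ∷ s₁ ∷ s₂ ∷ s₃ ∷ s₄ ∷ s₅ ∷ s₆ ∷ []) → VecAll.All Ω ws
        first-six (ω₀ ∷ ω₁ ∷ ω₂ ∷ ω₃ ∷ ω₄ ∷ ω₅ ∷ _) =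
          ω₀ VecAll.∷ ω₁ VecAll.∷ ω₂ VecAll.∷ ω₃ VecAll.∷ ω₄ VecAll.∷ ω₅ VecAll.∷ VecAll.[]
        last : All Ω (s₀ ∷ s₁ ∷ s₂ ∷ s₃ ∷ s₄ ∷ s₅ ∷ s₆ ∷ []) → Ω s₆
        last (_ ∷ _ ∷ _ ∷ _ ∷ _ ∷ _ ∷ ω₆ ∷ []) = ω₆

      root : Canonical (h 𝟎)
      root = subst Canonical (cong relabel (sym (cubeMap-𝟎 c ws))) canonical

      at-unit : ∀ k → value (h (unit k)) ≡ key (lookup ws k)
      at-unit k = cong (value ∘ relabel) (cubeMap-unit c ws k)

      at-𝟏 : value (h 𝟏) ≡ key s₆
      at-𝟏 = cong (value ∘ relabel) (trans (cubeMap-𝟏 c ws) (cong (c +_) total≡s₆))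

      rim-sorted : Linked (λ a b → value (h a) ≤ value (h b)) rim
      rim-sorted = along sorted
        where
        transfer : ∀ {m m′ n n′} → m ≡ m′ → n ≡ n′ → m′ ≤ n′ → m ≤ n
        transfer refl refl le = le
        along : Linked (λ a b → key a ≤ key b) (s₀ ∷ s₁ ∷ s₂ ∷ s₃ ∷ s₄ ∷ s₅ ∷ s₆ ∷ []) →
                Linked (λ a b → value (h a) ≤ value (h b)) rim
        along (p₀ ∷ p₁ ∷ p₂ ∷ p₃ ∷ p₄ ∷ p₅ ∷ [-]) =
          transfer (at-unit (# 0)) (at-unit (# 1)) p₀ ∷ transfer (at-unit (# 1)) (at-unit (# 2)) p₁ ∷
          transfer (at-unit (# 2)) (at-unit (# 3)) p₂ ∷ transfer (at-unit (# 3)) (at-unit (# 4)) p₃ ∷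
          transfer (at-unit (# 4)) (at-unit (# 5)) p₄ ∷ transfer (at-unit (# 5)) at-𝟏 p₅ ∷ [-]

      rim-strict : value (h (unit zero)) < value (h 𝟏)
      rim-strict = subst₂ _<_ (sym (at-unit zero)) (sym at-𝟏) strict

      hit : Hits
      hit with any? (λ i → ≡-dec Bool._≟_ (f (cubeMap c ws i)) y) (vectors 6)
      ... | yes found = let (i , fi≡y) = Any.satisfied found in cubeMap c ws i , fi≡y
      ... | no none = ⊥-elim (no-avoiding-hom h hom avoids root rim-sorted rim-strict)
        where
        avoids : ∀ i → h i ≢ 𝟎
        avoids i hi≡𝟎 = none (lose (∈-vectors i) (relabel-𝟎 (cubeMap c ws i) hi≡𝟎))

    -- Sorted spokes with two different keys have key s₀ < key s₆, so SortedSpokes applies.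
    sorted-hit : ∀ ss → length ss ≡ 7 → All Ω ss → Σ⟨ ss ⟩ ≡ 0# → Linked (λ a b → key a ≤ key b) ss →
      ∀ {a b} → a ∈ ss → b ∈ ss → key a ≢ key b → Hits
    sorted-hit ss len ω sum-zero sorted a∈ b∈ ka≢kb with seven ss len
    ... | (s₀ ∷ s₁ ∷ s₂ ∷ s₃ ∷ s₄ ∷ s₅ ∷ s₆ ∷ []) , refl =
      SortedSpokes.hit s₀ s₁ s₂ s₃ s₄ s₅ s₆ ω sum-zero sorted
        (≤∧≢⇒< (All.lookup (below-last key (s₀ ∷ s₁ ∷ s₂ ∷ s₃ ∷ s₄ ∷ s₅ ∷ []) s₆ sorted) (here refl)) not-constant)
      where
      not-constant : key s₀ ≢ key s₆
      not-constant k₀≡k₆ = ka≢kb (trans (All.lookup constant a∈) (sym (All.lookup constant b∈)))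
        where constant = sorted-constant key s₀ (s₁ ∷ s₂ ∷ s₃ ∷ s₄ ∷ s₅ ∷ []) s₆ sorted k₀≡k₆

  -- Every frame yields a preimage of y: either the centre, or (sorting the spokes by key,
  -- which keeps them in Ω, their sum and the separated pair) a point of the cube map.
  frame-hits : Frame → Hits
  frame-hits F with ≡-dec Bool._≟_ (f (Frame.centre F)) y
  ... | yes fc≡y = Frame.centre F , fc≡y
  ... | no fc≢y =
    sorted-hit (sort spokes) (trans (↭-length perm) seven-spokes) (All-resp-↭ (↭-sym perm) spokes-in-Ω)
      (trans (foldr-commMonoid isCommutativeMonoid (↭⇒↭ₛ perm)) spokes-sum) (sort-↗ spokes)
      (∈-resp-↭ (↭-sym perm) a-spoke) (∈-resp-↭ (↭-sym perm) b-spoke)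
      (λ ka≡kb → separated (relabel-injective _ _ (value-injective _ _ ka≡kb)))
    where
    open Frame F
    open Relabel centre fc≢y
    open Sort (On.decTotalOrder ≤-decTotalOrder key) using (sort; sort-↭; sort-↗)
    perm : sort spokes ↭ spokes
    perm = sort-↭ spokes

  steps : Γ → List Γ → List Γ
  steps x [] = []
  steps x (x′ ∷ xs) = (x + x′) ∷ steps x′ xs

  steps-sum : ∀ x xs z → Σ⟨ steps x (xs ++ z ∷ []) ⟩ ≡ x + z
  steps-sum x [] z = identityʳ (x + z)
  steps-sum x (x′ ∷ xs) z = begin
    (x + x′) + Σ⟨ steps x′ (xs ++ z ∷ []) ⟩ ≡⟨ cong ((x + x′) +_) (steps-sum x′ xs z) ⟩
    (x + x′) + (x′ + z)                     ≡⟨ assoc x x′ (x′ + z) ⟩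
    x + (x′ + (x′ + z))                     ≡⟨ cong (x +_) (cancelˡ x′ z) ⟩
    x + z                                   ∎

  -- A closed walk v₀ v₁ … v₆ v₀ gives a frame: the steps are the spokes; as PC(4) has no loop,
  -- f(vᵢ₋₁) ≠ f(vᵢ₊₁) for some i ∈ {1, 3, 5}, and vᵢ separates the spokes vᵢ₋₁ + vᵢ, vᵢ + vᵢ₊₁.
  module Walk (v₀ v₁ v₂ v₃ v₄ v₅ v₆ : Γ) (edge₀ : Cay v₀ v₁) (edge₁ : Cay v₁ v₂) (edge₂ : Cay v₂ v₃)
    (edge₃ : Cay v₃ v₄) (edge₄ : Cay v₄ v₅) (edge₅ : Cay v₅ v₆) (edge₆ : Cay v₆ v₀) where

    walk-spokes : List Γ
    walk-spokes = steps v₀ (v₁ ∷ v₂ ∷ v₃ ∷ v₄ ∷ v₅ ∷ v₆ ∷ v₀ ∷ [])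

    frame-at : ∀ p q r → (p + q) ∈ walk-spokes → (q + r) ∈ walk-spokes → f p ≢ f r → Frame
    frame-at p q r pq∈ qr∈ fp≢fr = record
      { centre = q
      ; spokes = walk-spokes
      ; seven-spokes = refl
      ; spokes-in-Ω = label edge₀ ∷ label edge₁ ∷ label edge₂ ∷ label edge₃ ∷ label edge₄ ∷ label edge₅ ∷ label edge₆ ∷ []
      ; spokes-sum = trans (steps-sum v₀ (v₁ ∷ v₂ ∷ v₃ ∷ v₄ ∷ v₅ ∷ v₆ ∷ []) v₀) (self-inverse v₀)
      ; a-spoke = pq∈
      ; b-spoke = qr∈
      ; separated = λ eq → fp≢fr (begin
          f p             ≡⟨ cong f (trans (cong (q +_) (comm p q)) (cancelˡ q p)) ⟨
          f (q + (p + q)) ≡⟨ eq ⟩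
          f (q + (q + r)) ≡⟨ cong f (cancelˡ q r) ⟩
          f r             ∎) }

    frame : Frame
    frame with ≡-dec Bool._≟_ (f v₀) (f v₂) | ≡-dec Bool._≟_ (f v₂) (f v₄) | ≡-dec Bool._≟_ (f v₄) (f v₆)
    ... | no d | _ | _ = frame-at v₀ v₁ v₂ (here refl) (there (here refl)) d
    ... | yes _ | no d | _ = frame-at v₂ v₃ v₄ (there (there (here refl))) (there (there (there (here refl)))) d
    ... | yes _ | yes _ | no d =
      frame-at v₄ v₅ v₆ (there (there (there (there (here refl))))) (there (there (there (there (there (here refl)))))) d
    ... | yes p | yes q | yes r =
      ⊥-elim (no-loop (f v₀) (subst (λ z → PC4Adj z (f v₀)) (sym (trans p (trans q r))) (f-hom v₆ v₀ edge₆)))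

corollary16 : {Γ : Set} (_+_ : Op₂ Γ) (0# : Γ) (-_ : Op₁ Γ) →
    IsGroup _≡_ _+_ 0# -_ → ((x : Γ) → x + x ≡ 0#) →
    (Ω : Γ → Set) →
    OddGirth (CayAdj _+_ -_ Ω) 7 →
    Σ (Γ → V4) (IsHom (CayAdj _+_ -_ Ω) PC4Adj) →
    (f : Γ → V4) → IsHom (CayAdj _+_ -_ Ω) PC4Adj f →
    (y : V4) → ∃ λ x → f x ≡ y
corollary16 _+_ 0# -_ isGroup self-inverse Ω (_ , (_ , v , _ , edge , closing) , _) _ f f-hom y =
  frame-hits (Walk.frame (v (# 0)) (v (# 1)) (v (# 2)) (v (# 3)) (v (# 4)) (v (# 5)) (v (# 6))
    (edge (# 0)) (edge (# 1)) (edge (# 2)) (edge (# 3)) (edge (# 4)) (edge (# 5)) closing)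
  where open Surjectivity isGroup self-inverse Ω f f-hom y
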